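{- Let $V$ be a finite set, let $S$ be a finite set of separations of $V$, and let $\tau$ be a tangle of $S$ that has exactly $k$ minimal oriented separations. Then there is a submodular order function $f^*$ on the set $S^*$ of all separations of $V$ such that $\tau$ extends to a $k$-tangle $\tau^* \supseteq \tau$ of $S^*$ with respect to $f^*$, and the minimal elements of $\tau^*$ are exactly the minimal elements of $\tau$.
   Context: A separation of a finite set $V$ is a bipartition $\{A, A^c\}$ of $V$; its two sides $A$ and $A^c$ are called oriented separations. For a set $S$ of separations, a tangle of $S$ is a set $\tau$ of oriented separations containing exactly one side of every separation in $S$ (and nothing else) such that $A_1 \cap A_2 \cap A_3 \neq \emptyset$ for all $A_1, A_2, A_3 \in \tau$ (not necessarily distinct). An element $A \in \tau$ is minimal if no $B \in \tau$ satisfies $B \subsetneq A$. An order function is a map $f$ from the set $S^*$ of all separations of $V$ to $\mathbb{N}_0$; one writes $f(A) := f(\{A,A^c\})$. It is submodular if $f(A \cap B) + f(A \cup B) \le f(A) + f(B)$ for all $A, B \subseteq V$. For $k\ge1$, a $k$-tangle of $S^*$ with respect to $f^*$ is a tangle of $\{s \in S^* : f^*(s) < k\}$. -}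

module Defs where

open import Data.Nat using (ℕ; _+_; _≤_; _<_)
open import Data.Fin.Subset using (Subset; ∁; _∩_; _∪_; _⊂_; Nonempty)
open import Data.List using (List; length)
open import Data.List.Relation.Unary.Unique.Propositional using (Unique)
open import Data.List.Membership.Propositional using (_∈_)
open import Data.Product using (Σ; _×_)
open import Data.Sum using (_⊎_)
open import Data.Empty using (⊥)
open import Relation.Binary.PropositionalEquality using (_≡_)
open import Relation.Nullary using (¬_)
open import Function.Bundles using (_⇔_)

-- The ground set V is Fin n.  An oriented separation is a subset A of V
-- (a 'Subset n'); the separation it belongs to is {A , ∁ A}.
-- A set of separations of V is represented by the predicate
-- "{A , ∁ A} ∈ S" on oriented separations, which must therefore be
-- invariant under complementation.
SepSet : ℕ → Set₁
SepSet n = Subset n → Set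

ComplementClosed : ∀ {n} → SepSet n → Set
ComplementClosed {n} S = (A : Subset n) → S A → S (∁ A)

OrSepSet : ℕ → Set₁
OrSepSet n = Subset n → Set

record IsTangle {n : ℕ} (S : SepSet n) (τ : OrSepSet n) : Set where
  field
    onlyS    : (A : Subset n) → τ A → S A
    someSide : (A : Subset n) → S A → τ A ⊎ τ (∁ A)
    oneSide  : (A : Subset n) → τ A → τ (∁ A) → ⊥
    profile  : (A₁ A₂ A₃ : Subset n) → τ A₁ → τ A₂ → τ A₃ →
               Nonempty (A₁ ∩ A₂ ∩ A₃)

Minimal : ∀ {n} → OrSepSet n → Subset n → Set
Minimal {n} τ A = τ A × ((B : Subset n) → τ B → ¬ (B ⊂ A))

HasExactlyMinimal : ∀ {n} → OrSepSet n → ℕ → Set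
HasExactlyMinimal {n} τ k =
  Σ (List (Subset n)) λ L →
    Unique L × ((A : Subset n) → (A ∈ L) ⇔ Minimal τ A) × length L ≡ k

-- An order function on the set S* of all separations of V: a map to ℕ
-- taking the same value on both sides of a separation (f(A) := f({A, ∁A})).
IsOrderFunction : ∀ {n} → (Subset n → ℕ) → Set
IsOrderFunction {n} f = (A : Subset n) → f A ≡ f (∁ A)

Submodular : ∀ {n} → (Subset n → ℕ) → Set
Submodular {n} f = (A B : Subset n) → f (A ∩ B) + f (A ∪ B) ≤ f A + f B

OrderBelow : ∀ {n} → (Subset n → ℕ) → ℕ → SepSet n
OrderBelow f k A = f A < k

IsKTangle : ∀ {n} → (Subset n → ℕ) → ℕ → OrSepSet n → Set
IsKTangle f k τ = IsTangle (OrderBelow f k) τ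

-- Let L list the minimal elements of τ, and let f(A) count the X ∈ L crossed by A, i.e. meeting
-- both A and ∁ A.  Each crossing indicator is submodular, hence so is f, and f(A) < |L| holds
-- exactly when some X ∈ L lies on one side of A.  Taking τ* to be the up-closure of L, the
-- separations of order < |L| are exactly those with a side in τ*; the triple-intersection property of τ*
-- is inherited from the triples of minimal elements, which every element of τ lies above.
module Submission where

open import Defs
open import Data.Nat using (ℕ; _+_; _≤_; _<_; z≤n; s≤s)
open import Data.Nat.Properties using (≤-refl; ≤-trans; +-mono-≤; +-monoˡ-≤; m≤m+n; m≤n+m; ≤-pred; +-commutativeSemigroup; module ≤-Reasoning)
open import Data.Nat.Induction using (<-wellFounded)
open import Algebra.Properties.CommutativeSemigroup +-commutativeSemigroup using (interchange)
open import Data.Fin.Subset using (Subset; ∁; _∩_; _∪_; _⊂_; _⊆_; Nonempty; ∣_∣)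
open import Data.Fin.Subset.Properties using (p∩q⊆p; p∩q⊆q; p⊆p∪q; q⊆p∪q; p⊆q⇒∁p⊇∁q; nonempty?; _∈?_; _⊆?_; ⊆-refl; ⊆-antisym; ⊆-⊂-trans; p⊂q⇒p⊆q; p⊂q⇒∣p∣<∣q∣; x∈p∩q⁺; x∈p∩q⁻; x∈p∪q⁻; x∈∁p⇒x∉p; x∉p⇒x∈∁p; x∉∁p⇒x∈p; x∈p⇒x∉∁p)
open import Data.List using (List; []; _∷_; length)
open import Data.List.Relation.Unary.Any using (Any; here; there; any?)
import Data.List.Relation.Unary.Any as Any
open import Data.List.Membership.Propositional using (find; lose) renaming (_∈_ to _∈ₗ_)
open import Data.Product using (Σ; _×_; _,_; proj₁; map₂)
open import Data.Sum using (_⊎_; inj₁; inj₂)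
open import Data.Empty using (⊥; ⊥-elim)
open import Relation.Nullary using (¬_; Dec; yes; no; _×-dec_)
open import Relation.Binary.PropositionalEquality using (_≡_; refl; subst)
open import Induction.WellFounded using (Acc; acc)
open import Function using (case_of_)
open import Function.Bundles using (_⇔_; mk⇔; Equivalence)

𝟙 : {P : Set} → Dec P → ℕ
𝟙 (yes _) = 1
𝟙 (no _)  = 0

𝟙≤1 : {P : Set} (p : Dec P) → 𝟙 p ≤ 1
𝟙≤1 (yes _) = ≤-refl
𝟙≤1 (no _)  = z≤n

𝟙-cong : {P Q : Set} → (P → Q) → (Q → P) → (p : Dec P) (q : Dec Q) → 𝟙 p ≡ 𝟙 q
𝟙-cong P→Q Q→P (yes _) (yes _) = refl
𝟙-cong P→Q Q→P (yes p) (no ¬q) = ⊥-elim (¬q (P→Q p))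
𝟙-cong P→Q Q→P (no ¬p) (yes q) = ⊥-elim (¬p (Q→P q))
𝟙-cong P→Q Q→P (no _)  (no _)  = refl

𝟙-pos : {P : Set} (p : Dec P) → P → 1 ≤ 𝟙 p
𝟙-pos (yes _) _  = ≤-refl
𝟙-pos (no ¬p) p = ⊥-elim (¬p p)

𝟙-pos-⊎ : {A B : Set} (a : Dec A) (b : Dec B) → A ⊎ B → 1 ≤ 𝟙 a + 𝟙 b
𝟙-pos-⊎ a b (inj₁ x) = ≤-trans (𝟙-pos a x) (m≤m+n (𝟙 a) (𝟙 b))
𝟙-pos-⊎ a b (inj₂ y) = ≤-trans (𝟙-pos b y) (m≤n+m (𝟙 b) (𝟙 a))

-- Submodularity for indicators: C and D play the roles of the meet and the join.
𝟙-submodular : {A B C D : Set} → (C × D → A × B) → (C ⊎ D → A ⊎ B) →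
  (a : Dec A) (b : Dec B) (c : Dec C) (d : Dec D) → 𝟙 c + 𝟙 d ≤ 𝟙 a + 𝟙 b
𝟙-submodular both one a b (yes c) (yes d) = let x , y = both (c , d) in +-mono-≤ (𝟙-pos a x) (𝟙-pos b y)
𝟙-submodular both one a b (yes c) (no _)  = 𝟙-pos-⊎ a b (one (inj₁ c))
𝟙-submodular both one a b (no _)  (yes d) = 𝟙-pos-⊎ a b (one (inj₂ d))
𝟙-submodular both one a b (no _)  (no _)  = z≤n

module _ {n : ℕ} where

  ∩-mono-⊆ : {A A′ B B′ : Subset n} → A ⊆ A′ → B ⊆ B′ → A ∩ B ⊆ A′ ∩ B′
  ∩-mono-⊆ {A} {B = B} A⊆A′ B⊆B′ x∈A∩B =
    let x∈A , x∈B = x∈p∩q⁻ A B x∈A∩B in x∈p∩q⁺ (A⊆A′ x∈A , B⊆B′ x∈B)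

  nonempty-mono : {A B : Subset n} → A ⊆ B → Nonempty A → Nonempty B
  nonempty-mono A⊆B = map₂ A⊆B

  Meets : Subset n → Subset n → Set
  Meets X A = Nonempty (X ∩ A)

  meets-monoʳ : {X A B : Subset n} → A ⊆ B → Meets X A → Meets X B
  meets-monoʳ A⊆B = nonempty-mono (∩-mono-⊆ ⊆-refl A⊆B)

  meets-∪ : {X : Subset n} (A B : Subset n) → Meets X (A ∪ B) → Meets X A ⊎ Meets X B
  meets-∪ {X} A B (x , x∈X∩A∪B) with x∈p∩q⁻ X (A ∪ B) x∈X∩A∪B
  ... | x∈X , x∈A∪B with x∈p∪q⁻ A B x∈A∪B
  ...   | inj₁ x∈A = inj₁ (x , x∈p∩q⁺ (x∈X , x∈A))
  ...   | inj₂ x∈B = inj₂ (x , x∈p∩q⁺ (x∈X , x∈B))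

  meets-∁∩ : {X : Subset n} (A B : Subset n) → Meets X (∁ (A ∩ B)) → Meets X (∁ A) ⊎ Meets X (∁ B)
  meets-∁∩ {X} A B (x , x∈X∩∁A∩B) with x∈p∩q⁻ X (∁ (A ∩ B)) x∈X∩∁A∩B
  ... | x∈X , x∈∁A∩B with x ∈? A
  ...   | no x∉A  = inj₁ (x , x∈p∩q⁺ (x∈X , x∉p⇒x∈∁p x∉A))
  ...   | yes x∈A = inj₂ (x , x∈p∩q⁺ (x∈X , x∉p⇒x∈∁p λ x∈B → x∈∁p⇒x∉p x∈∁A∩B (x∈p∩q⁺ (x∈A , x∈B))))

  Crosses : Subset n → Subset n → Set
  Crosses X A = Meets X A × Meets X (∁ A)

  crosses? : (X A : Subset n) → Dec (Crosses X A)
  crosses? X A = nonempty? (X ∩ A) ×-dec nonempty? (X ∩ ∁ A)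

  crosses-∁⁺ : {X A : Subset n} → Crosses X A → Crosses X (∁ A)
  crosses-∁⁺ (meetsA , meets∁A) = meets∁A , meets-monoʳ (λ x∈A → x∉p⇒x∈∁p (x∈p⇒x∉∁p x∈A)) meetsA

  crosses-∁⁻ : {X A : Subset n} → Crosses X (∁ A) → Crosses X A
  crosses-∁⁻ (meets∁A , meets∁∁A) = meets-monoʳ (λ x∈∁∁A → x∉∁p⇒x∈p (x∈∁p⇒x∉p x∈∁∁A)) meets∁∁A , meets∁A

  crosses-∩×∪ : {X : Subset n} (A B : Subset n) →
    Crosses X (A ∩ B) × Crosses X (A ∪ B) → Crosses X A × Crosses X B
  crosses-∩×∪ A B ((meetsA∩B , _) , (_ , meets∁A∪B)) =
    (meets-monoʳ (p∩q⊆p A B) meetsA∩B , meets-monoʳ (p⊆q⇒∁p⊇∁q (p⊆p∪q B)) meets∁A∪B) ,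
    (meets-monoʳ (p∩q⊆q A B) meetsA∩B , meets-monoʳ (p⊆q⇒∁p⊇∁q (q⊆p∪q A B)) meets∁A∪B)

  crosses-∩⊎∪ : {X : Subset n} (A B : Subset n) →
    Crosses X (A ∩ B) ⊎ Crosses X (A ∪ B) → Crosses X A ⊎ Crosses X B
  crosses-∩⊎∪ A B (inj₁ (meetsA∩B , meets∁A∩B)) with meets-∁∩ A B meets∁A∩B
  ... | inj₁ meets∁A = inj₁ (meets-monoʳ (p∩q⊆p A B) meetsA∩B , meets∁A)
  ... | inj₂ meets∁B = inj₂ (meets-monoʳ (p∩q⊆q A B) meetsA∩B , meets∁B)
  crosses-∩⊎∪ A B (inj₂ (meetsA∪B , meets∁A∪B)) with meets-∪ A B meetsA∪B
  ... | inj₁ meetsA = inj₁ (meetsA , meets-monoʳ (p⊆q⇒∁p⊇∁q (p⊆p∪q B)) meets∁A∪B)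
  ... | inj₂ meetsB = inj₂ (meetsB , meets-monoʳ (p⊆q⇒∁p⊇∁q (q⊆p∪q A B)) meets∁A∪B)

  ⊆⇒¬crosses : {X A : Subset n} → X ⊆ A → ¬ Crosses X A
  ⊆⇒¬crosses {X} {A} X⊆A (_ , x , x∈X∩∁A) =
    let x∈X , x∈∁A = x∈p∩q⁻ X (∁ A) x∈X∩∁A in x∈∁p⇒x∉p x∈∁A (X⊆A x∈X)

  ¬crosses⇒⊆⊎⊆∁ : {X A : Subset n} → ¬ Crosses X A → X ⊆ A ⊎ X ⊆ ∁ A
  ¬crosses⇒⊆⊎⊆∁ {X} {A} ¬crosses with nonempty? (X ∩ A)
  ... | no ¬meetsA = inj₂ λ x∈X → x∉p⇒x∈∁p λ x∈A → ¬meetsA (_ , x∈p∩q⁺ (x∈X , x∈A))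
  ... | yes meetsA = inj₁ λ {x} x∈X → case x ∈? A of λ where
    (yes x∈A) → x∈A
    (no x∉A)  → ⊥-elim (¬crosses (meetsA , x , x∈p∩q⁺ (x∈X , x∉p⇒x∈∁p x∉A)))

  crossing : Subset n → Subset n → ℕ
  crossing X A = 𝟙 (crosses? X A)

  crossing-isOrderFunction : (X : Subset n) → IsOrderFunction (crossing X)
  crossing-isOrderFunction X A = 𝟙-cong crosses-∁⁺ crosses-∁⁻ (crosses? X A) (crosses? X (∁ A))

  crossing-submodular : (X : Subset n) → Submodular (crossing X)
  crossing-submodular X A B =
    𝟙-submodular (crosses-∩×∪ A B) (crosses-∩⊎∪ A B)
      (crosses? X A) (crosses? X B) (crosses? X (A ∩ B)) (crosses? X (A ∪ B))

+-isOrderFunction : ∀ {n} {f g : Subset n → ℕ} →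
  IsOrderFunction f → IsOrderFunction g → IsOrderFunction (λ A → f A + g A)
+-isOrderFunction f-sym g-sym A rewrite f-sym A | g-sym A = refl

+-submodular : ∀ {n} {f g : Subset n → ℕ} →
  Submodular f → Submodular g → Submodular (λ A → f A + g A)
+-submodular {f = f} {g} f-sub g-sub A B = begin
  (f (A ∩ B) + g (A ∩ B)) + (f (A ∪ B) + g (A ∪ B)) ≡⟨ interchange (f (A ∩ B)) _ _ _ ⟩
  (f (A ∩ B) + f (A ∪ B)) + (g (A ∩ B) + g (A ∪ B)) ≤⟨ +-mono-≤ (f-sub A B) (g-sub A B) ⟩
  (f A + f B) + (g A + g B)                         ≡⟨ interchange (f A) _ _ _ ⟩
  (f A + g A) + (f B + g B)                         ∎
  where open ≤-Reasoning

module _ {n : ℕ} where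

  crossingNumber : List (Subset n) → Subset n → ℕ
  crossingNumber []      A = 0
  crossingNumber (X ∷ L) A = crossing X A + crossingNumber L A

  crossingNumber-isOrderFunction : (L : List (Subset n)) → IsOrderFunction (crossingNumber L)
  crossingNumber-isOrderFunction []      A = refl
  crossingNumber-isOrderFunction (X ∷ L) =
    +-isOrderFunction {f = crossing X} (crossing-isOrderFunction X) (crossingNumber-isOrderFunction L)

  crossingNumber-submodular : (L : List (Subset n)) → Submodular (crossingNumber L)
  crossingNumber-submodular []      A B = z≤n
  crossingNumber-submodular (X ∷ L) =
    +-submodular {f = crossing X} (crossing-submodular X) (crossingNumber-submodular L)

  crossingNumber≤length : (L : List (Subset n)) (A : Subset n) → crossingNumber L A ≤ length L
  crossingNumber≤length []      A = z≤n
  crossingNumber≤length (X ∷ L) A = +-mono-≤ (𝟙≤1 (crosses? X A)) (crossingNumber≤length L A)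

  crossingNumber<length⁺ : {L : List (Subset n)} {A : Subset n} →
    Any (λ X → ¬ Crosses X A) L → crossingNumber L A < length L
  crossingNumber<length⁺ {X ∷ L} {A} (here ¬crosses) with crosses? X A
  ... | yes crosses = ⊥-elim (¬crosses crosses)
  ... | no _        = s≤s (crossingNumber≤length L A)
  crossingNumber<length⁺ {X ∷ L} {A} (there any) =
    s≤s (≤-trans (+-monoˡ-≤ (crossingNumber L A) (𝟙≤1 (crosses? X A))) (crossingNumber<length⁺ any))

  crossingNumber<length⁻ : (L : List (Subset n)) (A : Subset n) →
    crossingNumber L A < length L → Any (λ X → ¬ Crosses X A) L
  crossingNumber<length⁻ (X ∷ L) A lt with crosses? X A
  ... | yes _       = there (crossingNumber<length⁻ L A (≤-pred lt))
  ... | no ¬crosses = here ¬crosses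

Up : ∀ {n} → List (Subset n) → OrSepSet n
Up L B = Any (_⊆ B) L

EnumeratesMinimal : ∀ {n} → OrSepSet n → List (Subset n) → Set
EnumeratesMinimal {n} τ L = (A : Subset n) → A ∈ₗ L ⇔ Minimal τ A

TriplyIntersecting : ∀ {n} → OrSepSet n → Set
TriplyIntersecting {n} ρ = (A₁ A₂ A₃ : Subset n) → ρ A₁ → ρ A₂ → ρ A₃ → Nonempty (A₁ ∩ A₂ ∩ A₃)

triplyIntersecting⇒¬bothSides : ∀ {n} {ρ : OrSepSet n} → TriplyIntersecting ρ →
  (A : Subset n) → ρ A → ρ (∁ A) → ⊥
triplyIntersecting⇒¬bothSides meets A ρA ρ∁A with meets A (∁ A) (∁ A) ρA ρ∁A ρ∁A
... | x , x∈A∩∁A∩∁A with x∈p∩q⁻ A (∁ A ∩ ∁ A) x∈A∩∁A∩∁A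
...   | x∈A , x∈∁A∩∁A = x∈∁p⇒x∉p (proj₁ (x∈p∩q⁻ (∁ A) (∁ A) x∈∁A∩∁A)) x∈A

⊆∧¬⊂⇒≡ : ∀ {n} {A B : Subset n} → A ⊆ B → ¬ A ⊂ B → A ≡ B
⊆∧¬⊂⇒≡ {A = A} A⊆B ¬A⊂B = ⊆-antisym A⊆B λ {x} x∈B → case x ∈? A of λ where
  (yes x∈A) → x∈A
  (no x∉A)  → ⊥-elim (¬A⊂B (A⊆B , x , x∈B , x∉A))

module _ {n : ℕ} {τ : OrSepSet n} {L : List (Subset n)} (enumerates : EnumeratesMinimal τ L) where

  ∈⇒minimal : {X : Subset n} → X ∈ₗ L → Minimal τ X
  ∈⇒minimal {X} = Equivalence.to (enumerates X)

  -- Induction on |A|: if no X ∈ L lies below A, then nothing in τ lies strictly below A either,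
  -- so A itself is minimal and hence in L.
  Up-⊇ : (A : Subset n) → τ A → Up L A
  Up-⊇ A = go A (<-wellFounded ∣ A ∣)
    where
    go : (A : Subset n) → Acc _<_ ∣ A ∣ → τ A → Up L A
    go A (acc rec) τA with any? (_⊆? A) L
    ... | yes below = below
    ... | no ¬below = ⊥-elim (¬below (lose (Equivalence.from (enumerates A) (τA , noneBelow)) ⊆-refl))
      where
      noneBelow : (B : Subset n) → τ B → ¬ B ⊂ A
      noneBelow B τB B⊂A =
        ¬below (Any.map (λ X⊆B {x} x∈X → p⊂q⇒p⊆q B⊂A (X⊆B x∈X)) (go B (rec (p⊂q⇒∣p∣<∣q∣ B⊂A)) τB))

  minimal-Up⇔ : (A : Subset n) → Minimal (Up L) A ⇔ Minimal τ A
  minimal-Up⇔ A = mk⇔ to from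
    where
    to : Minimal (Up L) A → Minimal τ A
    to (upA , minimalA) with find upA
    ... | X , X∈L , X⊆A =
      subst (Minimal τ) (⊆∧¬⊂⇒≡ X⊆A (minimalA X (lose X∈L ⊆-refl))) (∈⇒minimal X∈L)
    from : Minimal τ A → Minimal (Up L) A
    from minimalA@(_ , noneBelow) = lose (Equivalence.from (enumerates A) minimalA) ⊆-refl , noneUpBelow
      where
      noneUpBelow : (B : Subset n) → Up L B → ¬ B ⊂ A
      noneUpBelow B upB B⊂A =
        let X , X∈L , X⊆B = find upB in noneBelow X (proj₁ (∈⇒minimal X∈L)) (⊆-⊂-trans X⊆B B⊂A)

  Up-triplyIntersecting : TriplyIntersecting τ → TriplyIntersecting (Up L)
  Up-triplyIntersecting τ-meets A₁ A₂ A₃ upA₁ upA₂ upA₃ =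
    let X₁ , X₁∈L , X₁⊆A₁ = find upA₁
        X₂ , X₂∈L , X₂⊆A₂ = find upA₂
        X₃ , X₃∈L , X₃⊆A₃ = find upA₃
    in nonempty-mono (∩-mono-⊆ X₁⊆A₁ (∩-mono-⊆ X₂⊆A₂ X₃⊆A₃))
         (τ-meets X₁ X₂ X₃ (in-τ X₁∈L) (in-τ X₂∈L) (in-τ X₃∈L))
    where
    in-τ : {X : Subset n} → X ∈ₗ L → τ X
    in-τ X∈L = proj₁ (∈⇒minimal X∈L)

  Up-isKTangle : TriplyIntersecting τ → IsKTangle (crossingNumber L) (length L) (Up L)
  Up-isKTangle τ-meets = record
    { onlyS    = λ A upA → crossingNumber<length⁺ (Any.map ⊆⇒¬crosses upA)
    ; someSide = someSide
    ; oneSide  = triplyIntersecting⇒¬bothSides (Up-triplyIntersecting τ-meets)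
    ; profile  = Up-triplyIntersecting τ-meets
    }
    where
    someSide : (A : Subset n) → crossingNumber L A < length L → Up L A ⊎ Up L (∁ A)
    someSide A lt with find (crossingNumber<length⁻ L A lt)
    ... | X , X∈L , ¬crosses with ¬crosses⇒⊆⊎⊆∁ ¬crosses
    ...   | inj₁ X⊆A  = inj₁ (lose X∈L X⊆A)
    ...   | inj₂ X⊆∁A = inj₂ (lose X∈L X⊆∁A)

lemma3p9 : (n : ℕ) (S : SepSet n) → ComplementClosed S →
    (τ : OrSepSet n) → IsTangle S τ →
    (k : ℕ) → HasExactlyMinimal τ k →
    Σ (Subset n → ℕ) λ f →
      IsOrderFunction f × Submodular f ×
      Σ (OrSepSet n) λ τ* →
        IsKTangle f k τ* ×
        ((A : Subset n) → τ A → τ* A) ×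
        ((A : Subset n) → Minimal τ* A ⇔ Minimal τ A)
lemma3p9 n S _ τ isTangle k (L , _ , enumerates , refl) =
  crossingNumber L , crossingNumber-isOrderFunction L , crossingNumber-submodular L ,
  Up L , Up-isKTangle enumerates (IsTangle.profile isTangle) , Up-⊇ enumerates , minimal-Up⇔ enumerates
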